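{- Let $W$ be the set of all integers that are not prime numbers (so $W$ contains all integers $\le 1$ and all composite positive integers). Then $W$ admits a minimal complement and a minimal asymptotic complement in $\mathbb{Z}$.
   Context: For nonempty $A,B\subseteq\mathbb{Z}$, $A+B=\{a+b: a\in A,b\in B\}$. Given nonempty $W,C\subseteq \mathbb{Z}$: $C$ is a complement to $W$ if $W+C=\mathbb{Z}$; a minimal complement if it is a complement but $C\setminus\{c\}$ is not for every $c\in C$. $C$ is an asymptotic complement to $W$ if $\mathbb{Z}\setminus(W+C)$ is finite; a minimal asymptotic complement if it is an asymptotic complement but $C\setminus\{c\}$ is not for every $c\in C$. -}

module Defs where

open import Level using (0ℓ)
open import Data.Nat using (ℕ)
open import Data.Nat.Primality using (Prime)
open import Data.Integer using (ℤ; +_; _+_)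
open import Data.Product using (Σ; ∃; _×_)
open import Data.List using (List)
open import Data.List.Membership.Propositional using (_∈_)
open import Relation.Nullary using (¬_)
open import Relation.Binary.PropositionalEquality using (_≡_; _≢_)
open import Relation.Unary using (Pred)

SubsetZ : Set₁
SubsetZ = Pred ℤ 0ℓ

IsPrimeZ : ℤ → Set
IsPrimeZ z = ∃ λ (p : ℕ) → z ≡ + p × Prime p

NonPrimes : SubsetZ
NonPrimes z = ¬ IsPrimeZ z

Nonempty : SubsetZ → Set
Nonempty A = ∃ λ a → A a

_⊕_ : SubsetZ → SubsetZ → SubsetZ
(A ⊕ B) z = ∃ λ a → ∃ λ b → A a × B b × z ≡ a + b

_∖｛_｝ : SubsetZ → ℤ → SubsetZ
(C ∖｛ c ｝) x = C x × x ≢ c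

FiniteZ : SubsetZ → Set
FiniteZ A = ∃ λ (L : List ℤ) → ∀ z → A z → z ∈ L

IsComplement : SubsetZ → SubsetZ → Set
IsComplement W C = Nonempty C × (∀ z → (W ⊕ C) z)

IsMinimalComplement : SubsetZ → SubsetZ → Set
IsMinimalComplement W C =
  IsComplement W C × (∀ c → C c → ¬ IsComplement W (C ∖｛ c ｝))

IsAsymptoticComplement : SubsetZ → SubsetZ → Set
IsAsymptoticComplement W C = Nonempty C × FiniteZ (λ z → ¬ (W ⊕ C) z)

IsMinimalAsymptoticComplement : SubsetZ → SubsetZ → Set
IsMinimalAsymptoticComplement W C =
  IsAsymptoticComplement W C × (∀ c → C c → ¬ IsAsymptoticComplement W (C ∖｛ c ｝))

module Submission where

-- W = ℤ ∖ {primes} has both a minimal complement and a minimal asymptotic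
-- complement; the set C = {0, 7} is both at once.
--
-- * C is a complement: a non-prime z is z + 0, and for a prime p the
--   number p - 7 is not prime, since of p and p + 7 one is even and
--   larger than 2 (with the single exception p = 2, where 2 + 7 = 9).
-- * C is minimal even as an asymptotic complement: removing one element
--   leaves a set D ⊆ {c}, and then W + D misses every p + c with p prime.
--   As there are primes beyond every bound (a prime factor of n! + 1
--   exceeds n), these misses escape any finite list.

open import Defs
open import Data.Product using (∃; _×_; _,_)
open import Data.Sum using (_⊎_; inj₁; inj₂)
open import Data.Empty using (⊥-elim)
open import Data.Nat as ℕ using (ℕ; zero; suc; s≤s; z≤n; _!)
open import Data.Nat.Properties as ℕP using ()
open import Data.Nat.Divisibility
  using (_∣_; divides; ∣-trans; m∣m*n; ∣m+n∣m⇒∣n; ∣1⇒≡1; m≤n⇒m!∣n!)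
open import Data.Nat.Primality
  using (Prime; composite; composite⇒¬prime; prime?; prime⇒nonZero; prime⇒nonTrivial)
open import Data.Nat.Primality.Factorisation using (PrimeFactorisation; factorise)
open import Data.Nat.ListAction using (product)
open import Data.Integer as ℤ using (ℤ; +_; -[1+_]; _+_; _-_)
open import Data.Integer.Properties as ℤP using ()
open import Algebra.Properties.AbelianGroup ℤP.+-0-abelianGroup
  using (//-rightDividesˡ; //-rightDividesʳ)
open import Data.List using (List; []; _∷_)
open import Data.List.Membership.Propositional using (_∈_)
open import Data.List.Relation.Unary.All using (All; _∷_)
open import Data.List.Relation.Unary.Any using (here; there)
open import Relation.Nullary using (¬_; yes; no)
open import Relation.Binary.PropositionalEquality
  using (_≡_; _≢_; refl; sym; trans; cong; subst; module ≡-Reasoning)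

[x+c]-c≡x : ∀ x c → x + c - c ≡ x
[x+c]-c≡x x c = //-rightDividesʳ c x

[x-c]+c≡x : ∀ x c → x - c + c ≡ x
[x-c]+c≡x x c = //-rightDividesˡ c x

even⊎odd : ∀ n → 2 ∣ n ⊎ 2 ∣ suc n
even⊎odd zero = inj₁ (divides 0 refl)
even⊎odd (suc n) with even⊎odd n
... | inj₁ (divides q n≡q*2) = inj₂ (divides (suc q) (cong (λ m → suc (suc m)) n≡q*2))
... | inj₂ 2∣1+n = inj₁ 2∣1+n

even⇒¬prime : ∀ {n} → 2 ℕ.< n → 2 ∣ n → ¬ Prime n
even⇒¬prime 2<n 2∣n = composite⇒¬prime (composite {2} 2<n 2∣n)

-- The numbers p and p + 7 are never both prime: 2 + 7 = 9 = 3 · 3, and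
-- for p ≥ 3 one of p and p + 7 is even and larger than 2.
prime⇒¬prime[+7] : ∀ p → Prime p → ¬ Prime (p ℕ.+ 7)
prime⇒¬prime[+7] 0 pr _ with () ← prime⇒nonZero pr
prime⇒¬prime[+7] 1 pr _ with () ← prime⇒nonTrivial pr
prime⇒¬prime[+7] 2 _ = composite⇒¬prime (composite {3} (s≤s (s≤s (s≤s (s≤s z≤n)))) (divides 3 refl))
prime⇒¬prime[+7] p@(suc (suc (suc r))) pr with even⊎odd p
... | inj₁ 2∣p = ⊥-elim (even⇒¬prime (s≤s (s≤s (s≤s z≤n))) 2∣p pr)
... | inj₂ (divides k 1+p≡k*2) = even⇒¬prime (s≤s (s≤s (s≤s z≤n))) (divides (k ℕ.+ 3) p+7≡[k+3]*2)
  where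
  open ≡-Reasoning
  p+7≡[k+3]*2 : p ℕ.+ 7 ≡ (k ℕ.+ 3) ℕ.* 2
  p+7≡[k+3]*2 = begin
    p ℕ.+ 7           ≡⟨ ℕP.+-comm p 7 ⟩
    6 ℕ.+ suc p       ≡⟨ cong (6 ℕ.+_) 1+p≡k*2 ⟩
    6 ℕ.+ k ℕ.* 2     ≡⟨ ℕP.+-comm 6 (k ℕ.* 2) ⟩
    k ℕ.* 2 ℕ.+ 3 ℕ.* 2 ≡⟨ ℕP.*-distribʳ-+ 2 k 3 ⟨
    (k ℕ.+ 3) ℕ.* 2   ∎

-- Every n > 1 has a prime divisor: the first factor of its prime
-- factorisation (the factorisation is nonempty because n ≢ 1).
primeDivisor : ∀ n → 1 ℕ.< n → ∃ λ p → Prime p × p ∣ n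
primeDivisor n@(suc n-1) 1<n = firstFactor factors isFactorisation factorsPrime
  where
  open PrimeFactorisation (factorise n)
  firstFactor : ∀ ps → n ≡ product ps → All Prime ps → ∃ λ p → Prime p × p ∣ n
  firstFactor [] n≡1 _ = ⊥-elim (ℕP.<-irrefl (sym n≡1) 1<n)
  firstFactor (p ∷ ps) n≡p*Πps (pr ∷ _) =
    p , pr , divides (product ps) (trans n≡p*Πps (ℕP.*-comm p (product ps)))

∣! : ∀ {p n} → 0 ℕ.< p → p ℕ.≤ n → p ∣ n !
∣! {suc k} _ p≤n = ∣-trans (m∣m*n (k !)) (m≤n⇒m!∣n! p≤n)

-- Euclid: there are primes beyond every bound. A prime factor p of n! + 1
-- cannot be ≤ n, since otherwise p ∣ n! and hence p ∣ 1.
primeAbove : ∀ n → ∃ λ p → Prime p × n ℕ.< p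
primeAbove n with primeDivisor (n ! ℕ.+ 1) (ℕP.+-monoˡ-≤ 1 (ℕP.1≤n! n))
... | p , pr , p∣n!+1 with n ℕ.<? p
...   | yes n<p = p , pr , n<p
...   | no n≮p = ⊥-elim (p≢1 (∣1⇒≡1 (∣m+n∣m⇒∣n p∣n!+1 (∣! 0<p (ℕP.≮⇒≥ n≮p)))))
  where
  instance
    _ = prime⇒nonTrivial pr
  0<p : 0 ℕ.< p
  0<p = ℕP.<-trans (s≤s z≤n) (ℕ.nonTrivial⇒n>1 p)
  p≢1 : p ≢ 1
  p≢1 = ℕ.nonTrivial⇒≢1

subsingleton-misses : ∀ (W D : SubsetZ) c a → (∀ d → D d → d ≡ c) → ¬ W a → ¬ (W ⊕ D) (a + c)
subsingleton-misses W D c a D⊆c a∉W (w , d , w∈W , d∈D , a+c≡w+d) = a∉W (subst W w≡a w∈W)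
  where
  open ≡-Reasoning
  w≡a : w ≡ a
  w≡a = begin
    w         ≡⟨ [x+c]-c≡x w d ⟨
    w + d - d ≡⟨ cong (_- d) a+c≡w+d ⟨
    a + c - d ≡⟨ cong (λ e → a + c - e) (D⊆c d d∈D) ⟩
    a + c - c ≡⟨ [x+c]-c≡x a c ⟩
    a         ∎

complement⇒asymptotic : ∀ {W C} → IsComplement W C → IsAsymptoticComplement W C
complement⇒asymptotic (C≢∅ , covers) = C≢∅ , [] , λ z z∉W+C → ⊥-elim (z∉W+C (covers z))

spread : ℤ → List ℤ → ℕ
spread c [] = 0
spread c (x ∷ xs) = ℤ.∣ x - c ∣ ℕ.+ spread c xs

finite⇒bounded : ∀ {A} c → FiniteZ A → ∃ λ B → ∀ z → A z → ℤ.∣ z - c ∣ ℕ.≤ B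
finite⇒bounded c (L , A⊆L) = spread c L , λ z z∈A → ∈⇒≤spread L (A⊆L z z∈A)
  where
  ∈⇒≤spread : ∀ {z} L → z ∈ L → ℤ.∣ z - c ∣ ℕ.≤ spread c L
  ∈⇒≤spread (x ∷ xs) (here refl) = ℕP.m≤m+n _ _
  ∈⇒≤spread (x ∷ xs) (there z∈xs) = ℕP.≤-trans (∈⇒≤spread xs z∈xs) (ℕP.m≤n+m _ _)

-- A set D ⊆ {c} is not an asymptotic complement of the non-primes: the
-- numbers p + c with p prime are all missed by NonPrimes ⊕ D, and by
-- Euclid they lie arbitrarily far from c.
subsingleton-¬asymptotic : ∀ D c → (∀ d → D d → d ≡ c) → ¬ IsAsymptoticComplement NonPrimes D
subsingleton-¬asymptotic D c D⊆c (_ , finite) with finite⇒bounded c finite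
... | B , bounded with primeAbove B
... | p , pr , B<p = ℕP.<⇒≱ B<p (subst (ℕ._≤ B) ∣[p+c]-c∣≡p (bounded (+ p + c) p+c-missed))
  where
  p+c-missed : ¬ (NonPrimes ⊕ D) (+ p + c)
  p+c-missed = subsingleton-misses NonPrimes D c (+ p) D⊆c (λ p∉W → p∉W (p , refl , pr))
  ∣[p+c]-c∣≡p : ℤ.∣ + p + c - c ∣ ≡ p
  ∣[p+c]-c∣≡p = cong ℤ.∣_∣ ([x+c]-c≡x (+ p) c)

C₀₇ : SubsetZ
C₀₇ x = x ≡ + 0 ⊎ x ≡ + 7

prime⇒nonPrime[-7] : ∀ n → Prime n → NonPrimes (+ n - + 7)
prime⇒nonPrime[-7] n pr (q , n-7≡q , prq) = prime⇒¬prime[+7] q prq (subst Prime n≡q+7 pr)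
  where
  n≡q+7 : n ≡ q ℕ.+ 7
  n≡q+7 = ℤP.+-injective (trans (sym ([x-c]+c≡x (+ n) (+ 7))) (cong (_+ + 7) n-7≡q))

C₀₇-complement : IsComplement NonPrimes C₀₇
C₀₇-complement = (+ 0 , inj₁ refl) , covers
  where
  as-z+0 : ∀ z → NonPrimes z → (NonPrimes ⊕ C₀₇) z
  as-z+0 z z∈W = z , + 0 , z∈W , inj₁ refl , sym (ℤP.+-identityʳ z)
  covers : ∀ z → (NonPrimes ⊕ C₀₇) z
  covers z@(-[1+ _ ]) = as-z+0 z λ ()
  covers z@(+ n) with prime? n
  ... | no ¬pr = as-z+0 z λ { (_ , refl , pr) → ¬pr pr }
  ... | yes pr = + n - + 7 , + 7 , prime⇒nonPrime[-7] n pr , inj₂ refl , sym ([x-c]+c≡x z (+ 7))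

C₀₇-minus-one : ∀ c → C₀₇ c → ∃ λ c′ → ∀ d → (C₀₇ ∖｛ c ｝) d → d ≡ c′
C₀₇-minus-one c (inj₁ refl) = + 7 , λ { d (inj₁ refl , d≢0) → ⊥-elim (d≢0 refl) ; d (inj₂ d≡7 , _) → d≡7 }
C₀₇-minus-one c (inj₂ refl) = + 0 , λ { d (inj₁ d≡0 , _) → d≡0 ; d (inj₂ refl , d≢7) → ⊥-elim (d≢7 refl) }

C₀₇-minimal : ∀ c → C₀₇ c → ¬ IsAsymptoticComplement NonPrimes (C₀₇ ∖｛ c ｝)
C₀₇-minimal c c∈C with C₀₇-minus-one c c∈C
... | c′ , D⊆c′ = subsingleton-¬asymptotic (C₀₇ ∖｛ c ｝) c′ D⊆c′

lemma4p1 : (∃ λ (C : SubsetZ) → IsMinimalComplement NonPrimes C)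
    × (∃ λ (C : SubsetZ) → IsMinimalAsymptoticComplement NonPrimes C)
lemma4p1 =
    (C₀₇ , C₀₇-complement , λ c c∈C complement → C₀₇-minimal c c∈C (complement⇒asymptotic complement))
  , (C₀₇ , complement⇒asymptotic C₀₇-complement , C₀₇-minimal)
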